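{- Let $G_\tau$ be a bidirected graph without a b-circuit. Then $\mathrm{Ft}(\mathrm{Rt}(\mathrm{Ft}(G_\tau)))=\mathrm{Ft}(G_\tau)$.
   Context: A graph $G=(V,E)$ is finite, with loops and multiple edges allowed. A half-edge is a pair $(e,x)$ with $e$ incident with $x$ (a loop has two half-edges at its vertex). A bidirected graph $G_\tau=(V,E;\tau)$ is a graph with a map $\tau$ assigning $+1$ or $-1$ to every half-edge; an edge with ends $x,y$ and $\tau(e,x)=\alpha,\tau(e,y)=\beta$ is written $\{x^\alpha,y^\beta\}$. A partial graph of $G_\tau$ is $(V,F;\tau|_F)$ with $F\subseteq E$. A chain is $x_0,e_1,x_1,\ldots,e_k,x_k$ where $e_i$ has ends $x_{i-1},x_i$; when $e_i$ is traversed from $x_{i-1}$ to $x_i$, $\tau(e_i,x_{i-1}),\tau(e_i,x_i)$ denote the values at the corresponding half-edges. For $\alpha,\beta\in\{\pm1\}$ a b-walk from $x^\alpha$ to $y^\beta$ is a chain $x=x_0,e_1,\ldots,e_k,x_k=y$ with $k\ge1$, $\tau(e_1,x_0)=\alpha$, $\tau(e_k,x_k)=\beta$ and $\tau(e_i,x_i)+\tau(e_{i+1},x_i)=0$ for $1\le i\le k-1$. A b-path from $x^\alpha$ to $y^\beta$ is a b-walk from $x^\alpha$ to $y^\beta$ minimal with these properties (no b-walk from $x^\alpha$ to $y^\beta$ has as edge sequence a proper subsequence, in the same order, of its edge sequence); $x=y$ allowed. A b-circuit is a b-path from $x^\alpha$ to $x^{ -\alpha}$. The transitive closure $\mathrm{Ft}(G_\tau)$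 is the bidirected graph on $V$ whose edges are those of $G_\tau$ together with an edge $\{x^\alpha,y^\beta\}$ (a loop if $x=y$) for every $x^\alpha,y^\beta$ such that $G_\tau$ has a b-path from $x^\alpha$ to $y^\beta$. For a bidirected graph $K_\tau$ and a partial graph $H_\tau$ of $K_\tau$, $\mathrm{ft}(K_\tau;H_\tau)$ is the partial graph of $K_\tau$ whose edges are the edges of $K_\tau$ that are edges of $H_\tau$ or are of the form $\{x^\alpha,y^\beta\}$ with a b-path from $x^\alpha$ to $y^\beta$ in $H_\tau$. A transitive reduction $\mathrm{Rt}(K_\tau)$ of $K_\tau$ is a minimal partial graph $R$ of $K_\tau$ with $\mathrm{ft}(K_\tau;R)=K_\tau$; for $K_\tau=\mathrm{Ft}(G_\tau)$ with $G_\tau$ without b-circuits it is unique. -}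

module Defs where

open import Data.Nat using (ℕ; _<_)
open import Data.Fin using (Fin)
open import Data.Sign using (Sign; opposite)
open import Data.Bool using (Bool; true; false)
open import Data.List using (List; []; _∷_; map; length)
open import Data.List.Relation.Binary.Sublist.Propositional using (_⊆_)
open import Data.Product using (Σ; ∃; _×_; _,_)
open import Data.Sum using (_⊎_; inj₁; inj₂)
open import Data.Unit using (⊤)
open import Relation.Nullary using (¬_)
open import Relation.Binary.PropositionalEquality using (_≡_)

-- A signed edge {x^α , y^β}: the first end x with τ(e,x)=α, the second end y with τ(e,y)=β.
-- (For a loop x = y; the two half-edges are the "first" and "second" end.)
record Link (n : ℕ) : Set where
  constructor ⟨_,_,_,_⟩
  field
    x : Fin n
    α : Sign
    y : Fin n
    β : Sign
open Link public

flipL : ∀ {n} → Link n → Link n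
flipL ⟨ a , s , b , t ⟩ = ⟨ b , t , a , s ⟩

record BiGraph (n : ℕ) : Set₁ where
  field
    Edge : Set
    link : Edge → Link n
open BiGraph public

Sub : ∀ {n} → BiGraph n → Set₁
Sub Γ = Edge Γ → Set

-- A traversal of an edge: true = from the first end to the second, false = reverse.
record Step {n : ℕ} (Γ : BiGraph n) : Set where
  constructor step
  field
    edge : Edge Γ
    fwd  : Bool
open Step public

module _ {n : ℕ} {Γ : BiGraph n} where
  from : Step Γ → Fin n
  from (step e true)  = x (link Γ e)
  from (step e false) = y (link Γ e)
  dep : Step Γ → Sign
  dep (step e true)  = α (link Γ e)
  dep (step e false) = β (link Γ e)
  to : Step Γ → Fin n
  to (step e true)  = y (link Γ e)
  to (step e false) = x (link Γ e)
  arr : Step Γ → Sign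
  arr (step e true)  = β (link Γ e)
  arr (step e false) = α (link Γ e)

-- b-walk from a^s to b^t in the partial graph (Γ , P), given by its nonempty list of steps;
-- consecutive steps satisfy τ(e_i,x_i) + τ(e_{i+1},x_i) = 0.
data IsBWalk {n : ℕ} (Γ : BiGraph n) (P : Sub Γ) :
       Fin n → Sign → Fin n → Sign → List (Step Γ) → Set where
  last : ∀ {a s b t} (st : Step Γ) → P (edge st) →
         from st ≡ a → dep st ≡ s → to st ≡ b → arr st ≡ t →
         IsBWalk Γ P a s b t (st ∷ [])
  more : ∀ {a s b t rest} (st : Step Γ) → P (edge st) →
         from st ≡ a → dep st ≡ s →
         IsBWalk Γ P (to st) (opposite (arr st)) b t rest →
         IsBWalk Γ P a s b t (st ∷ rest)

edges : ∀ {n} {Γ : BiGraph n} → List (Step Γ) → List (Edge Γ)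
edges = map edge

IsBPath : ∀ {n} (Γ : BiGraph n) (P : Sub Γ) → Fin n → Sign → Fin n → Sign → List (Step Γ) → Set
IsBPath Γ P a s b t w =
  IsBWalk Γ P a s b t w ×
  (∀ w' → IsBWalk Γ P a s b t w' →
     ¬ (edges w' ⊆ edges w × length (edges w') < length (edges w)))

HasBPath : ∀ {n} (Γ : BiGraph n) (P : Sub Γ) → Link n → Set
HasBPath Γ P l = ∃ λ w → IsBPath Γ P (x l) (α l) (y l) (β l) w

HasBCircuit : ∀ {n} (Γ : BiGraph n) (P : Sub Γ) → Set
HasBCircuit Γ P = ∃ λ a → ∃ λ s → HasBPath Γ P ⟨ a , s , a , opposite s ⟩

-- Transitive closure: the ambient graph has the old edges plus one potential new edge per signed pair;
-- the closure of (Γ , P) keeps the old edges of P and the new edge {x^α,y^β} iff there is a b-path.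
FtGraph : ∀ {n} → BiGraph n → BiGraph n
FtGraph {n} Γ = record { Edge = Edge Γ ⊎ Link n ; link = lk }
  where
  lk : Edge Γ ⊎ Link n → Link n
  lk (inj₁ e) = link Γ e
  lk (inj₂ l) = l

Ft : ∀ {n} (Γ : BiGraph n) → Sub Γ → Sub (FtGraph Γ)
Ft Γ P (inj₁ e) = P e
Ft Γ P (inj₂ l) = HasBPath Γ P l

-- ft(K;H) = K, for K = (Γ , Kp) and H a partial graph of K
Generates : ∀ {n} (Γ : BiGraph n) (Kp H : Sub Γ) → Set
Generates Γ Kp H = ∀ e → Kp e → H e ⊎ HasBPath Γ H (link Γ e)

IsRt : ∀ {n} (Γ : BiGraph n) (Kp R : Sub Γ) → Set₁
IsRt Γ Kp R =
  (∀ e → R e → Kp e) ×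
  Generates Γ Kp R ×
  (¬ (Σ (Sub Γ) λ R' → (∀ e → R' e → R e) × Generates Γ Kp R' ×
        ∃ λ e → R e × ¬ R' e))

HasEdge : ∀ {n} (Γ : BiGraph n) (P : Sub Γ) → Link n → Set
HasEdge Γ P l = ∃ λ e → P e × (link Γ e ≡ l ⊎ link Γ e ≡ flipL l)

mkGraph : ∀ {n m} → (Fin m → Link n) → BiGraph n
mkGraph {n} {m} lk = record { Edge = Fin m ; link = lk }

All : ∀ {n} (Γ : BiGraph n) → Sub Γ
All Γ _ = ⊤

module Submission where

-- A b-path in R ⊆ Ft(G) unfolds, edge by edge, into a b-walk of G, and every b-walk contains a
-- b-path between the same signed ends (take a shortest walk among its finitely many oriented
-- subsequences); so Ft(R) adds nothing to Ft(G). Conversely each edge of Ft(G) lies in R or is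
-- generated by a b-path of R, hence lies in Ft(R).

open import Defs
open import Data.Nat using (ℕ; _<_; _<?_)
open import Data.Nat.Induction using (<-wellFounded)
open import Data.Fin using (Fin; _≟_)
open import Data.Sign using (opposite)
open import Data.Sign.Properties using (opposite-involutive) renaming (_≟_ to _≟ˢ_)
open import Data.Bool using (true; false; not)
open import Data.List using (List; []; _∷_; map; length; _++_; [_])
open import Data.List.Relation.Binary.Sublist.Propositional using (_⊆_; _∷_; _∷ʳ_)
open import Data.List.Membership.Propositional using (_∈_; lose)
open import Data.List.Membership.Propositional.Properties using (∈-map⁺; ∈-++⁺ˡ; ∈-++⁺ʳ)
open import Data.List.Relation.Unary.Any using (here; any?; satisfied)
open import Data.Product using (∃; _×_; _,_)
open import Data.Sum using (inj₁; inj₂)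
open import Data.Unit using (tt)
open import Function.Bundles using (_⇔_; mk⇔)
open import Induction.WellFounded using (Acc; acc)
open import Relation.Nullary using (¬_; Dec; yes; no)
open import Relation.Nullary.Decidable using (_×-dec_; map′)
open import Relation.Unary using (Decidable)
open import Relation.Binary.PropositionalEquality using (_≡_; refl; sym; subst)

flipStep : ∀ {n} {Γ : BiGraph n} → Step Γ → Step Γ
flipStep (step e d) = step e (not d)

reverseSteps : ∀ {n} {Γ : BiGraph n} → List (Step Γ) → List (Step Γ)
reverseSteps []       = []
reverseSteps (st ∷ w) = reverseSteps w ++ [ flipStep st ]

module _ {n : ℕ} {Γ : BiGraph n} {P : Sub Γ} where

  IsBWalk-++ : ∀ {a s b t c u w w′} → IsBWalk Γ P a s b t w →
               IsBWalk Γ P b (opposite t) c u w′ → IsBWalk Γ P a s c u (w ++ w′)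
  IsBWalk-++ (last st p refl refl refl refl) w′ = more st p refl refl w′
  IsBWalk-++ (more st p e₁ e₂ w) w′             = more st p e₁ e₂ (IsBWalk-++ w w′)

  IsBWalk-flipStep : ∀ (st : Step Γ) → P (edge st) →
                     IsBWalk Γ P (to st) (arr st) (from st) (dep st) [ flipStep st ]
  IsBWalk-flipStep (step e true)  p = last (step e false) p refl refl refl refl
  IsBWalk-flipStep (step e false) p = last (step e true) p refl refl refl refl

  IsBWalk-reverse : ∀ {a s b t w} → IsBWalk Γ P a s b t w → IsBWalk Γ P b t a s (reverseSteps w)
  IsBWalk-reverse (last st p refl refl refl refl) = IsBWalk-flipStep st p
  IsBWalk-reverse (more st p refl refl w)         = IsBWalk-++ (IsBWalk-reverse w) back
    where
    back : IsBWalk Γ P (to st) (opposite (opposite (arr st))) (from st) (dep st) [ flipStep st ]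
    back = subst (λ σ → IsBWalk Γ P (to st) σ (from st) (dep st) [ flipStep st ])
                 (sym (opposite-involutive (arr st))) (IsBWalk-flipStep st p)

orientedSublists : ∀ {n} {Γ : BiGraph n} → List (Step Γ) → List (List (Step Γ))
orientedSublists []       = [ [] ]
orientedSublists (st ∷ w) =
  orientedSublists w ++ map (step (edge st) true ∷_) (orientedSublists w)
                     ++ map (step (edge st) false ∷_) (orientedSublists w)

module _ {n : ℕ} {Γ : BiGraph n} where

  []∈orientedSublists : ∀ (w : List (Step Γ)) → [] ∈ orientedSublists w
  []∈orientedSublists []       = here refl
  []∈orientedSublists (st ∷ w) = ∈-++⁺ˡ ([]∈orientedSublists w)

  ∈-orientedSublists : ∀ (w′ w : List (Step Γ)) → edges w′ ⊆ edges w → w′ ∈ orientedSublists w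
  ∈-orientedSublists []       w        _         = []∈orientedSublists w
  ∈-orientedSublists w′       (st ∷ w) (_ ∷ʳ w⊆) = ∈-++⁺ˡ (∈-orientedSublists w′ w w⊆)
  ∈-orientedSublists (step _ true ∷ w′) (st ∷ w) (refl ∷ w⊆) =
    ∈-++⁺ʳ (orientedSublists w) (∈-++⁺ˡ (∈-map⁺ (step (edge st) true ∷_) (∈-orientedSublists w′ w w⊆)))
  ∈-orientedSublists (step _ false ∷ w′) (st ∷ w) (refl ∷ w⊆) =
    ∈-++⁺ʳ (orientedSublists w) (∈-++⁺ʳ (map (step (edge st) true ∷_) (orientedSublists w)) (∈-map⁺ (step (edge st) false ∷_) (∈-orientedSublists w′ w w⊆)))

module _ {n : ℕ} {Γ : BiGraph n} {P : Sub Γ} (P? : Decidable P) where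

  isBWalk? : ∀ a s b t w → Dec (IsBWalk Γ P a s b t w)
  isBWalk? a s b t [] = no λ ()
  isBWalk? a s b t (st ∷ []) =
    map′ (λ (p , e₁ , e₂ , e₃ , e₄) → last st p e₁ e₂ e₃ e₄) single
         (P? (edge st) ×-dec from st ≟ a ×-dec dep st ≟ˢ s ×-dec to st ≟ b ×-dec arr st ≟ˢ t)
    where
    single : IsBWalk Γ P a s b t [ st ] →
             P (edge st) × from st ≡ a × dep st ≡ s × to st ≡ b × arr st ≡ t
    single (last _ p e₁ e₂ e₃ e₄) = p , e₁ , e₂ , e₃ , e₄
    single (more _ _ _ _ ())
  isBWalk? a s b t (st ∷ rest@(_ ∷ _)) =
    map′ (λ (p , e₁ , e₂ , w) → more st p e₁ e₂ w) cons
         (P? (edge st) ×-dec from st ≟ a ×-dec dep st ≟ˢ s ×-dec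
          isBWalk? (to st) (opposite (arr st)) b t rest)
    where
    cons : IsBWalk Γ P a s b t (st ∷ rest) →
           P (edge st) × from st ≡ a × dep st ≡ s × IsBWalk Γ P (to st) (opposite (arr st)) b t rest
    cons (more _ p e₁ e₂ w) = p , e₁ , e₂ , w

  IsBWalk⇒HasBPath : ∀ {a s b t w} → IsBWalk Γ P a s b t w → HasBPath Γ P ⟨ a , s , b , t ⟩
  IsBWalk⇒HasBPath {a} {s} {b} {t} {w} = shortest w (<-wellFounded _)
    where
    shortest : ∀ w → Acc _<_ (length (edges w)) → IsBWalk Γ P a s b t w →
               HasBPath Γ P ⟨ a , s , b , t ⟩
    shortest w (acc shorter) walk
      with any? (λ w′ → isBWalk? a s b t w′ ×-dec length (edges w′) <? length (edges w))
                (orientedSublists w)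
    ... | yes found with satisfied found
    ...   | w′ , walk′ , w′<w = shortest w′ (shorter w′<w) walk′
    shortest w _ walk | no none =
      w , walk , λ w′ walk′ (w′⊆w , w′<w) → none (lose (∈-orientedSublists w′ w w′⊆w) (walk′ , w′<w))

module _ {n : ℕ} {Γ : BiGraph n} {P : Sub Γ} where

  Ft-step⇒IsBWalk : (st : Step (FtGraph Γ)) → Ft Γ P (edge st) →
                    ∃ (IsBWalk Γ P (from st) (dep st) (to st) (arr st))
  Ft-step⇒IsBWalk (step (inj₁ e) true)  p = [ step e true ] , last (step e true) p refl refl refl refl
  Ft-step⇒IsBWalk (step (inj₁ e) false) p = [ step e false ] , last (step e false) p refl refl refl refl
  Ft-step⇒IsBWalk (step (inj₂ l) true)  (w , walk , _) = w , walk
  Ft-step⇒IsBWalk (step (inj₂ l) false) (w , walk , _) = reverseSteps w , IsBWalk-reverse walk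

  IsBWalk-Ft⇒IsBWalk : ∀ {Q : Sub (FtGraph Γ)} → (∀ e → Q e → Ft Γ P e) →
                       ∀ {a s b t w} → IsBWalk (FtGraph Γ) Q a s b t w → ∃ (IsBWalk Γ P a s b t)
  IsBWalk-Ft⇒IsBWalk Q⊆ (last st q refl refl refl refl) = Ft-step⇒IsBWalk st (Q⊆ _ q)
  IsBWalk-Ft⇒IsBWalk Q⊆ (more st q refl refl rest)
    with Ft-step⇒IsBWalk st (Q⊆ _ q) | IsBWalk-Ft⇒IsBWalk Q⊆ rest
  ... | w , walk | w′ , walk′ = w ++ w′ , IsBWalk-++ walk walk′

  HasEdge-Ft-Ft⇒HasEdge-Ft : Decidable P → ∀ {Q : Sub (FtGraph Γ)} → (∀ e → Q e → Ft Γ P e) →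
    ∀ {l} → HasEdge (FtGraph (FtGraph Γ)) (Ft (FtGraph Γ) Q) l → HasEdge (FtGraph Γ) (Ft Γ P) l
  HasEdge-Ft-Ft⇒HasEdge-Ft P? Q⊆ (inj₁ e , q , ends) = e , Q⊆ e q , ends
  HasEdge-Ft-Ft⇒HasEdge-Ft P? Q⊆ (inj₂ l′ , (w , walk , _) , ends)
    with IsBWalk-Ft⇒IsBWalk Q⊆ walk
  ... | w′ , walk′ = inj₂ l′ , IsBWalk⇒HasBPath P? walk′ , ends

Generates⇒HasEdge-Ft : ∀ {n} {Γ : BiGraph n} {K R : Sub Γ} → Generates Γ K R →
                       ∀ {l} → HasEdge Γ K l → HasEdge (FtGraph Γ) (Ft Γ R) l
Generates⇒HasEdge-Ft {Γ = Γ} gen (e , k , ends) with gen e k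
... | inj₁ r    = inj₁ e , r , ends
... | inj₂ path = inj₂ (link Γ e) , path , ends

proposition49 : (n m : ℕ) (lk : Fin m → Link n) →
    ¬ HasBCircuit (mkGraph lk) (All (mkGraph lk)) →
    (R : Sub (FtGraph (mkGraph lk))) →
    IsRt (FtGraph (mkGraph lk)) (Ft (mkGraph lk) (All (mkGraph lk))) R →
    ∀ (l : Link n) →
      HasEdge (FtGraph (FtGraph (mkGraph lk))) (Ft (FtGraph (mkGraph lk)) R) l
        ⇔ HasEdge (FtGraph (mkGraph lk)) (Ft (mkGraph lk) (All (mkGraph lk))) l
proposition49 n m lk _ R (R⊆Ft , generates , _) l =
  mk⇔ (HasEdge-Ft-Ft⇒HasEdge-Ft (λ _ → yes tt) R⊆Ft) (Generates⇒HasEdge-Ft generates)
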